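{- Let $\Gamma$ be a simple graph on a finite set $X$ ($|X|\ge 3$). If for some point $x\in X$ the graph $\Gamma^x$ (on $X\setminus\{x\}$) is extensible, then for every $y\in X$ the graph $\Gamma^y$ (on $X\setminus\{y\}$) is extensible, and $\Gamma^x$ and $\Gamma^y$ have the same parameters.
   Context: The matrix of a simple graph on $X$ is $\mathcal{E}=(\varepsilon_{i,j})$ with $\varepsilon_{i,j}=-1$ if $i\neq j$ are adjacent and $1$ otherwise. Graphs with matrices $\mathcal{E}=(\varepsilon_{i,j})$, $\mathcal{E}'=(\varepsilon'_{i,j})$ are associated if there exist $\nu_i\in\{ -1,1\}$ with $\varepsilon'_{i,j}=\nu_i\nu_j\varepsilon_{i,j}$. For $x\in X$, ${}^x\Gamma$ is the unique graph associated to $\Gamma$ in which $x$ is isolated, and $\Gamma^x$ is the subgraph induced by ${}^x\Gamma$ on $X\setminus\{x\}$. A simple graph $(\Lambda,Y)$ is extensible with parameters $(t,s,\bar s)$ (integers) if: (1) $\Lambda$ has diameter $2$; (2) for every $y\in Y$: (a) the set $\Lambda(y,1)$ of neighbours of $y$ has $2s$ elements; (b) the set $\Lambda(y,2)$ of vertices at distance $2$ from $y$ has $2\bar s$ elements; (c) every $z\in\Lambda(y,1)$ is adjacent to exactly $\bar s$ points of $\Lambda(y,2)$ and exactly $t=2s-\bar s-1$ points of $\Lambda(y,1)$; (d) every $z\in\Lambda(y,2)$ is adjacent to exactly $s$ points of $\Lambda(y,2)$ and exactly $s$ points of $\Lambda(y,1)$; (3) every edge is contained in exactly $t=2s-\bar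 s-1$ triangles; (4) $|Y|=1+2s+2\bar s$. -}

module Defs where

open import Data.Nat using (ℕ; zero; suc; _+_; _*_)
open import Data.Bool using (Bool; true; false; not; _∧_; _∨_; _xor_; if_then_else_; T)
open import Data.Fin using (Fin; zero; suc; punchIn; _≟_)
open import Data.Product using (_×_; ∃₂)
open import Relation.Binary.PropositionalEquality using (_≡_; _≢_)
open import Relation.Nullary.Decidable using (⌊_⌋)

record SimpleGraph (m : ℕ) : Set where
  field
    adj    : Fin m → Fin m → Bool
    sym    : ∀ i j → adj i j ≡ adj j i
    irrefl : ∀ i → adj i i ≡ false
open SimpleGraph public

count : ∀ {m} → (Fin m → Bool) → ℕ
count {zero}  p = 0
count {suc m} p = (if p zero then 1 else 0) + count (λ i → p (suc i))

anyFin : ∀ {m} → (Fin m → Bool) → Bool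
anyFin {zero}  p = false
anyFin {suc m} p = p zero ∨ anyFin (λ i → p (suc i))

-- ^xΓ : the graph associated to Γ (switching with ν_i = -1 iff i ~ x)
-- in which x is isolated.  In ±1 notation ε'_{ij} = ν_i ν_j ε_{ij};
-- in Bool (true = adjacent = -1) this is xor.
switchIsolate : ∀ {m} → SimpleGraph m → Fin m → Fin m → Fin m → Bool
switchIsolate Γ x i j = adj Γ i j xor (adj Γ x i xor adj Γ x j)

-- Γ^x : subgraph induced by ^xΓ on X \ {x}; X \ {x} is identified with
-- Fin n via punchIn x : Fin n → Fin (suc n).
derived : ∀ {n} → SimpleGraph (suc n) → Fin (suc n) → Fin n → Fin n → Bool
derived Γ x i j = switchIsolate Γ x (punchIn x i) (punchIn x j)

module _ {m : ℕ} (a : Fin m → Fin m → Bool) where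

  dist2 : Fin m → Fin m → Bool
  dist2 y z = not ⌊ y ≟ z ⌋ ∧ not (a y z) ∧ anyFin (λ w → a y w ∧ a w z)

  Diameter2 : Set
  Diameter2 = (∀ y z → y ≢ z → T (a y z ∨ dist2 y z)) × ∃₂ (λ y z → T (dist2 y z))

  -- extensible with parameters (t, s, s̄); t = 2s - s̄ - 1 written as t + s̄ + 1 = 2s
  Extensible : (t s s̄ : ℕ) → Set
  Extensible t s s̄ =
      (t + s̄ + 1 ≡ 2 * s)
    × Diameter2
    × (∀ y →
          (count (a y) ≡ 2 * s)
        × (count (dist2 y) ≡ 2 * s̄)
        × (∀ z → T (a y z) →
              (count (λ w → a z w ∧ dist2 y w) ≡ s̄)
            × (count (λ w → a z w ∧ a y w) ≡ t))
        × (∀ z → T (dist2 y z) →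
              (count (λ w → a z w ∧ dist2 y w) ≡ s)
            × (count (λ w → a z w ∧ a y w) ≡ s)))
    × (∀ y z → T (a y z) → count (λ w → a y w ∧ a z w) ≡ t)
    × (m ≡ 1 + 2 * s + 2 * s̄)

-- Call a triple of points odd if it spans an odd number of edges of Γ; the odd triples form the
-- two-graph of Γ, and switching does not change it. Hence every Γ^x, with x re-attached as an
-- isolated point, has the same two-graph as Γ. Counting the edges of the triangles through a pair
-- {i, j} shows that Γ^x is extensible with parameters (t, s, s̄) exactly when these parameters are
-- admissible and every pair of points of X lies in 2s odd triples, a condition not involving x.
module Submission where

open import Algebra.Bundles using (CommutativeRing)
open import Data.Bool using (Bool; true; false; not; _∧_; _∨_; _xor_; if_then_else_; T)
open import Data.Bool.Properties
  using (xor-∧-commutativeRing; xor-same; xor-comm; xor-identityʳ; ∧-zeroʳ; ∧-identityʳ; ∨-inverseʳ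
        ; T-≡; T-∨)
open import Data.Empty using (⊥-elim)
open import Data.Fin using (Fin; zero; suc; punchIn; punchOut; _≟_)
open import Data.Fin.Properties using (punchInᵢ≢i; punchIn-injective; punchIn-punchOut)
open import Data.Nat using (ℕ; zero; suc; _+_; _*_; _<_; _≤_; s≤s; z≤n)
open import Data.Nat.Properties
  using (+-cancelˡ-≡; +-cancelʳ-≡; *-cancelˡ-≡; *-cancelˡ-<; *-monoʳ-<; +-comm; +-identityʳ
        ; +-commutativeSemigroup)
open import Data.Nat.Tactic.RingSolver using (solve-∀)
open import Data.Product using (_×_; _,_; proj₁; proj₂; ∃)
open import Data.Sum using (_⊎_; inj₁; inj₂; [_,_]′)
open import Function using (_∘_; _⇔_; mk⇔; Equivalence)
open import Relation.Binary.PropositionalEquality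
  using (_≡_; _≢_; refl; sym; trans; cong; cong₂; subst; module ≡-Reasoning)
open import Relation.Nullary using (Dec; ¬_; yes; no)
open import Relation.Nullary.Decidable using (⌊_⌋; isYes≗does; dec-true; dec-false)

open import Algebra.Properties.CommutativeSemigroup +-commutativeSemigroup using (interchange)
open CommutativeRing xor-∧-commutativeRing using (+-commutativeMonoid)
open import Algebra.Solver.CommutativeMonoid +-commutativeMonoid using (solve; _⊕_; _⊜_)
open import Defs hiding (sym)

open Equivalence using (to; from)

isYes-true : ∀ {A : Set} (a? : Dec A) → A → ⌊ a? ⌋ ≡ true
isYes-true a? a = trans (isYes≗does a?) (dec-true a? a)

isYes-false : ∀ {A : Set} (a? : Dec A) → ¬ A → ⌊ a? ⌋ ≡ false
isYes-false a? ¬a = trans (isYes≗does a?) (dec-false a? ¬a)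

punchIn-view : ∀ {n} (x i : Fin (suc n)) → i ≡ x ⊎ ∃ λ k → punchIn x k ≡ i
punchIn-view x i with i ≟ x
... | yes i≡x = inj₁ i≡x
... | no  i≢x = inj₂ (punchOut (i≢x ∘ sym) , punchIn-punchOut (i≢x ∘ sym))

true-or-false : ∀ b → b ≡ true ⊎ b ≡ false
true-or-false true  = inj₁ refl
true-or-false false = inj₂ refl

⟦_⟧ : Bool → ℕ
⟦ b ⟧ = if b then 1 else 0

count-cong : ∀ {m} {p q : Fin m → Bool} → (∀ i → p i ≡ q i) → count p ≡ count q
count-cong {zero}  p≗q = refl
count-cong {suc m} p≗q = cong₂ _+_ (cong ⟦_⟧ (p≗q zero)) (count-cong (p≗q ∘ suc))

count-+ : ∀ {m} {p q r u : Fin m → Bool} →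
          (∀ i → ⟦ p i ⟧ + ⟦ q i ⟧ ≡ ⟦ r i ⟧ + ⟦ u i ⟧) →
          count p + count q ≡ count r + count u
count-+ {zero}  pointwise = refl
count-+ {suc m} {p} {q} {r} {u} pointwise = begin
    (⟦ p zero ⟧ + count (p ∘ suc)) + (⟦ q zero ⟧ + count (q ∘ suc))
  ≡⟨ interchange ⟦ p zero ⟧ (count (p ∘ suc)) ⟦ q zero ⟧ (count (q ∘ suc)) ⟩
    (⟦ p zero ⟧ + ⟦ q zero ⟧) + (count (p ∘ suc) + count (q ∘ suc))
  ≡⟨ cong₂ _+_ (pointwise zero) (count-+ (pointwise ∘ suc)) ⟩
    (⟦ r zero ⟧ + ⟦ u zero ⟧) + (count (r ∘ suc) + count (u ∘ suc))
  ≡⟨ interchange ⟦ r zero ⟧ ⟦ u zero ⟧ (count (r ∘ suc)) (count (u ∘ suc)) ⟩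
    (⟦ r zero ⟧ + count (r ∘ suc)) + (⟦ u zero ⟧ + count (u ∘ suc))
  ∎
  where open ≡-Reasoning

count-true : ∀ m → count {m} (λ _ → true) ≡ m
count-true zero    = refl
count-true (suc m) = cong suc (count-true m)

count-false : ∀ m → count {m} (λ _ → false) ≡ 0
count-false zero    = refl
count-false (suc m) = count-false m

count-∨-∧ : ∀ {m} (p q : Fin m → Bool) →
            count p + count q ≡ count (λ i → p i ∨ q i) + count (λ i → p i ∧ q i)
count-∨-∧ p q = count-+ (λ i → inclusion-exclusion (p i) (q i))
  where
  inclusion-exclusion : ∀ x y → ⟦ x ⟧ + ⟦ y ⟧ ≡ ⟦ x ∨ y ⟧ + ⟦ x ∧ y ⟧
  inclusion-exclusion true  true  = refl
  inclusion-exclusion true  false = refl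
  inclusion-exclusion false y     = sym (+-identityʳ ⟦ y ⟧)

count-punchIn : ∀ {n} (y : Fin (suc n)) (p : Fin (suc n) → Bool) →
                count p ≡ ⟦ p y ⟧ + count (p ∘ punchIn y)
count-punchIn zero p = refl
count-punchIn {suc n} (suc y) p = begin
    ⟦ p zero ⟧ + count (p ∘ suc)
  ≡⟨ cong (⟦ p zero ⟧ +_) (count-punchIn y (p ∘ suc)) ⟩
    ⟦ p zero ⟧ + (⟦ p (suc y) ⟧ + count (p ∘ suc ∘ punchIn y))
  ≡⟨ swap ⟦ p zero ⟧ ⟦ p (suc y) ⟧ (count (p ∘ suc ∘ punchIn y)) ⟩
    ⟦ p (suc y) ⟧ + (⟦ p zero ⟧ + count (p ∘ suc ∘ punchIn y))
  ∎
  where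
  open ≡-Reasoning
  swap : ∀ a b c → a + (b + c) ≡ b + (a + c)
  swap = solve-∀

count-≟ : ∀ {m} (p : Fin m → Bool) (y : Fin m) → count (λ w → p w ∧ ⌊ y ≟ w ⌋) ≡ ⟦ p y ⟧
count-≟ {suc m} p y = begin
    count (λ w → p w ∧ ⌊ y ≟ w ⌋)
  ≡⟨ count-punchIn y (λ w → p w ∧ ⌊ y ≟ w ⌋) ⟩
    ⟦ p y ∧ ⌊ y ≟ y ⌋ ⟧ + count (λ k → p (punchIn y k) ∧ ⌊ y ≟ punchIn y k ⌋)
  ≡⟨ cong₂ _+_ (cong ⟦_⟧ (trans (cong (p y ∧_) (isYes-true (y ≟ y) refl)) (∧-identityʳ _)))
               (count-cong λ k →
                  trans (cong (p (punchIn y k) ∧_) (isYes-false (y ≟ _) (punchInᵢ≢i y k ∘ sym)))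
                        (∧-zeroʳ _)) ⟩
    ⟦ p y ⟧ + count {m} (λ _ → false)
  ≡⟨ trans (cong (⟦ p y ⟧ +_) (count-false m)) (+-identityʳ _) ⟩
    ⟦ p y ⟧
  ∎
  where open ≡-Reasoning

0<count : ∀ {m} {p : Fin m → Bool} (i : Fin m) → T (p i) → 0 < count p
0<count {suc m} {p} i pᵢ rewrite count-punchIn i p with p i
... | true = s≤s z≤n

count-witness : ∀ {m} (p : Fin m → Bool) → 0 < count p → ∃ λ i → T (p i)
count-witness {suc m} p 0<c with p zero in p₀
... | true  = zero , subst T (sym p₀) _
... | false = let i , pᵢ = count-witness (p ∘ suc) 0<c in suc i , pᵢ

anyFin-intro : ∀ {m} {p : Fin m → Bool} (i : Fin m) → T (p i) → T (anyFin p)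
anyFin-intro zero    pᵢ = from T-∨ (inj₁ pᵢ)
anyFin-intro (suc i) pᵢ = from T-∨ (inj₂ (anyFin-intro i pᵢ))

+-cancel-middle : ∀ a {x y} c → a + x + c ≡ a + y + c → x ≡ y
+-cancel-middle a c e = +-cancelˡ-≡ a _ _ (+-cancelʳ-≡ c _ _ e)

cancel⇔ʳ : ∀ {a a′ b c x y} → a + c ≡ b + 2 * x → a′ + c ≡ b + 2 * y → a ≡ a′ ⇔ x ≡ y
cancel⇔ʳ {a} {a′} {b} {c} e e′ = mk⇔
  (λ a≡a′ → *-cancelˡ-≡ _ _ 2 (+-cancelˡ-≡ b _ _ (trans (sym e) (trans (cong (_+ c) a≡a′) e′))))
  (λ x≡y → +-cancelʳ-≡ c a a′ (trans e (trans (cong (λ v → b + 2 * v) x≡y) (sym e′))))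

cancel⇔ˡ : ∀ {a a′ c x y} → c ≡ a + 2 * x → c ≡ a′ + 2 * y → a ≡ a′ ⇔ x ≡ y
cancel⇔ˡ {a} {a′} {x = x} {y} e e′ = mk⇔
  (λ a≡a′ → *-cancelˡ-≡ _ _ 2
              (+-cancelˡ-≡ a′ _ _ (trans (cong (_+ 2 * x) (sym a≡a′)) (trans (sym e) e′))))
  (λ x≡y → +-cancelʳ-≡ (2 * y) a a′ (trans (cong (λ v → a + 2 * v) (sym x≡y)) (trans (sym e) e′)))

-- Two-graphs

oddTriangle : ∀ {m} → (Fin m → Fin m → Bool) → Fin m → Fin m → Fin m → Bool
oddTriangle a i j k = a i j xor (a j k xor a k i)

-- For a simple graph the degenerate triangles (k = i or k = j) are never odd, so this is the
-- number of triples of the two-graph containing {i, j}.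
pairDegree : ∀ {m} → (Fin m → Fin m → Bool) → Fin m → Fin m → ℕ
pairDegree a i j = count (oddTriangle a i j)

RegularTwoGraph : ∀ {m} → (Fin m → Fin m → Bool) → ℕ → Set
RegularTwoGraph a d = ∀ i j → i ≢ j → pairDegree a i j ≡ d

-- The two-graph of a with an isolated point ∞ adjoined is regular of degree d: the pair {∞, i}
-- lies in count (a i) odd triples and the pair {i, j} in ⟦ a i j ⟧ + pairDegree a i j.
ExtendedTwoGraphRegular : ∀ {m} → (Fin m → Fin m → Bool) → ℕ → Set
ExtendedTwoGraphRegular a d =
  (∀ i → count (a i) ≡ d) × (∀ i j → i ≢ j → ⟦ a i j ⟧ + pairDegree a i j ≡ d)

switch : ∀ {m} → (Fin m → Fin m → Bool) → (Fin m → Bool) → Fin m → Fin m → Bool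
switch a ν i j = a i j xor (ν i xor ν j)

oddTriangle-switch : ∀ {m} (a : Fin m → Fin m → Bool) (ν : Fin m → Bool) i j k →
                     oddTriangle (switch a ν) i j k ≡ oddTriangle a i j k
oddTriangle-switch a ν i j k =
  trans (regroup (a i j) (a j k) (a k i) (ν i) (ν j) (ν k))
        (trans (cong (oddTriangle a i j k xor_) (pairs-vanish (ν i) (ν j) (ν k))) (xor-identityʳ _))
  where
  regroup : ∀ x y z u v w →
            (x xor (u xor v)) xor ((y xor (v xor w)) xor (z xor (w xor u)))
              ≡ (x xor (y xor z)) xor ((u xor u) xor ((v xor v) xor (w xor w)))
  regroup = solve 6 (λ x y z u v w →
    (x ⊕ (u ⊕ v)) ⊕ ((y ⊕ (v ⊕ w)) ⊕ (z ⊕ (w ⊕ u)))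
      ⊜ (x ⊕ (y ⊕ z)) ⊕ ((u ⊕ u) ⊕ ((v ⊕ v) ⊕ (w ⊕ w)))) refl
  pairs-vanish : ∀ u v w → (u xor u) xor ((v xor v) xor (w xor w)) ≡ false
  pairs-vanish u v w rewrite xor-same u | xor-same v | xor-same w = refl

oddTriangle-rotate : ∀ {m} (a : Fin m → Fin m → Bool) i j k → oddTriangle a i j k ≡ oddTriangle a k i j
oddTriangle-rotate a i j k =
  solve 3 (λ x y z → x ⊕ (y ⊕ z) ⊜ z ⊕ (x ⊕ y)) refl (a i j) (a j k) (a k i)

pairDegree-sym : ∀ {m} (G : SimpleGraph m) i j → pairDegree (adj G) i j ≡ pairDegree (adj G) j i
pairDegree-sym G i j = count-cong λ k → reverse k
  where
  reverse : ∀ k → oddTriangle (adj G) i j k ≡ oddTriangle (adj G) j i k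
  reverse k rewrite SimpleGraph.sym G j i | SimpleGraph.sym G i k | SimpleGraph.sym G k j =
    cong (adj G i j xor_) (xor-comm (adj G j k) (adj G k i))

-- Strongly regular graphs

commonNeighbours : ∀ {m} → (Fin m → Fin m → Bool) → Fin m → Fin m → ℕ
commonNeighbours a i j = count (λ w → a i w ∧ a j w)

nonNeighbour : ∀ {m} → (Fin m → Fin m → Bool) → Fin m → Fin m → Bool
nonNeighbour a y w = not ⌊ y ≟ w ⌋ ∧ not (a y w)

StronglyRegular : ∀ {m} → (Fin m → Fin m → Bool) → (k t μ : ℕ) → Set
StronglyRegular a k t μ =
    (∀ i → count (a i) ≡ k)
  × (∀ i j → a i j ≡ true → commonNeighbours a i j ≡ t)
  × (∀ i j → i ≢ j → a i j ≡ false → commonNeighbours a i j ≡ μ)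

Admissible : ℕ → (t s s̄ : ℕ) → Set
Admissible m t s s̄ = (t + s̄ + 1 ≡ 2 * s) × (m ≡ 1 + 2 * s + 2 * s̄) × (0 < s̄)

module _ {m : ℕ} (G : SimpleGraph m) where

  private
    a = adj G

  adjacent⇒≢ : ∀ {i j} → a i j ≡ true → i ≢ j
  adjacent⇒≢ {i} aᵢⱼ refl with () ← trans (sym (irrefl G i)) aᵢⱼ

  edge-count : ∀ {i j} → a i j ≡ true →
               (⟦ a i j ⟧ + pairDegree a i j) + (count (a i) + count (a j))
                 ≡ (1 + m) + 2 * commonNeighbours a i j
  edge-count {i} {j} aᵢⱼ = begin
      (⟦ a i j ⟧ + pairDegree a i j) + (count (a i) + count (a j))
    ≡⟨ cong₂ (λ e c → (⟦ e ⟧ + pairDegree a i j) + c) aᵢⱼ (count-∨-∧ (a i) (a j)) ⟩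
      (1 + pairDegree a i j) + (count (λ k → a i k ∨ a j k) + commonNeighbours a i j)
    ≡⟨ regroup (pairDegree a i j) _ _ ⟩
      1 + (pairDegree a i j + count (λ k → a i k ∨ a j k)) + commonNeighbours a i j
    ≡⟨ cong (λ c → 1 + c + commonNeighbours a i j) (count-+ triangle) ⟩
      1 + (count {m} (λ _ → true) + commonNeighbours a i j) + commonNeighbours a i j
    ≡⟨ cong (λ c → 1 + (c + commonNeighbours a i j) + commonNeighbours a i j) (count-true m) ⟩
      1 + (m + commonNeighbours a i j) + commonNeighbours a i j
    ≡⟨ double m (commonNeighbours a i j) ⟩
      (1 + m) + 2 * commonNeighbours a i j
    ∎
    where
    open ≡-Reasoning
    triangle : ∀ k → ⟦ oddTriangle a i j k ⟧ + ⟦ a i k ∨ a j k ⟧ ≡ ⟦ true ⟧ + ⟦ a i k ∧ a j k ⟧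
    triangle k rewrite aᵢⱼ | SimpleGraph.sym G k i with a i k | a j k
    ... | true  | true  = refl
    ... | true  | false = refl
    ... | false | true  = refl
    ... | false | false = refl
    regroup : ∀ p c n → (1 + p) + (c + n) ≡ 1 + (p + c) + n
    regroup = solve-∀
    double : ∀ m n → 1 + (m + n) + n ≡ (1 + m) + 2 * n
    double = solve-∀

  nonEdge-count : ∀ {i j} → a i j ≡ false →
                  count (a i) + count (a j) ≡ (⟦ a i j ⟧ + pairDegree a i j) + 2 * commonNeighbours a i j
  nonEdge-count {i} {j} aᵢⱼ = begin
      count (a i) + count (a j)
    ≡⟨ count-∨-∧ (a i) (a j) ⟩
      count (λ k → a i k ∨ a j k) + commonNeighbours a i j
    ≡⟨ cong (_+ commonNeighbours a i j) (sym (+-identityʳ _)) ⟩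
      count (λ k → a i k ∨ a j k) + 0 + commonNeighbours a i j
    ≡⟨ cong (λ c → count (λ k → a i k ∨ a j k) + c + commonNeighbours a i j) (sym (count-false m)) ⟩
      count (λ k → a i k ∨ a j k) + count {m} (λ _ → false) + commonNeighbours a i j
    ≡⟨ cong (_+ commonNeighbours a i j) (count-+ triangle) ⟩
      pairDegree a i j + commonNeighbours a i j + commonNeighbours a i j
    ≡⟨ double (pairDegree a i j) (commonNeighbours a i j) ⟩
      pairDegree a i j + 2 * commonNeighbours a i j
    ≡⟨ cong (λ e → ⟦ e ⟧ + pairDegree a i j + 2 * commonNeighbours a i j) (sym aᵢⱼ) ⟩
      (⟦ a i j ⟧ + pairDegree a i j) + 2 * commonNeighbours a i j
    ∎
    where
    open ≡-Reasoning
    double : ∀ p n → p + n + n ≡ p + 2 * n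
    double = solve-∀
    triangle : ∀ k → ⟦ a i k ∨ a j k ⟧ + ⟦ false ⟧ ≡ ⟦ oddTriangle a i j k ⟧ + ⟦ a i k ∧ a j k ⟧
    triangle k rewrite aᵢⱼ | SimpleGraph.sym G k i with a i k | a j k
    ... | true  | true  = refl
    ... | true  | false = refl
    ... | false | true  = refl
    ... | false | false = refl

  module _ {t s s̄ : ℕ} (param : t + s̄ + 1 ≡ 2 * s) (size : m ≡ 1 + 2 * s + 2 * s̄) where

    private
      edge⇔ : (∀ i → count (a i) ≡ 2 * s) → ∀ {i j} → a i j ≡ true →
              ⟦ a i j ⟧ + pairDegree a i j ≡ 2 * s ⇔ commonNeighbours a i j ≡ t
      edge⇔ degree {i} {j} aᵢⱼ =
        cancel⇔ʳ {b = 1 + m} (trans (cong₂ (λ u v → ⟦ a i j ⟧ + pairDegree a i j + (u + v))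
                                           (sym (degree i)) (sym (degree j)))
                                    (edge-count aᵢⱼ))
                             parameters
        where
        open ≡-Reasoning
        parameters : 2 * s + (2 * s + 2 * s) ≡ (1 + m) + 2 * t
        parameters = begin
            2 * s + (2 * s + 2 * s)            ≡⟨ regroup s ⟩
            2 * s + 2 * (2 * s)                ≡⟨ cong (λ v → 2 * s + 2 * v) (sym param) ⟩
            2 * s + 2 * (t + s̄ + 1)            ≡⟨ regroup′ s s̄ t ⟩
            (1 + (1 + 2 * s + 2 * s̄)) + 2 * t  ≡⟨ cong (λ v → (1 + v) + 2 * t) (sym size) ⟩
            (1 + m) + 2 * t                    ∎
          where
          regroup : ∀ s → 2 * s + (2 * s + 2 * s) ≡ 2 * s + 2 * (2 * s)
          regroup = solve-∀
          regroup′ : ∀ s s̄ t → 2 * s + 2 * (t + s̄ + 1) ≡ (1 + (1 + 2 * s + 2 * s̄)) + 2 * t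
          regroup′ = solve-∀

      nonEdge⇔ : (∀ i → count (a i) ≡ 2 * s) → ∀ {i j} → a i j ≡ false →
                 ⟦ a i j ⟧ + pairDegree a i j ≡ 2 * s ⇔ commonNeighbours a i j ≡ s
      nonEdge⇔ degree {i} {j} aᵢⱼ =
        cancel⇔ˡ (trans (cong₂ _+_ (sym (degree i)) (sym (degree j))) (nonEdge-count aᵢⱼ)) refl

    stronglyRegular⇔extendedTwoGraphRegular :
      StronglyRegular a (2 * s) t s ⇔ ExtendedTwoGraphRegular a (2 * s)
    stronglyRegular⇔extendedTwoGraphRegular = mk⇔
      (λ (degree , edgeCN , nonEdgeCN) → degree , λ i j i≢j →
         [ (λ aᵢⱼ → from (edge⇔ degree aᵢⱼ) (edgeCN i j aᵢⱼ))
         , (λ aᵢⱼ → from (nonEdge⇔ degree aᵢⱼ) (nonEdgeCN i j i≢j aᵢⱼ)) ]′ (true-or-false (a i j)))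
      (λ (degree , pairs) → degree
         , (λ i j aᵢⱼ → to (edge⇔ degree aᵢⱼ) (pairs i j (adjacent⇒≢ aᵢⱼ)))
         , (λ i j i≢j aᵢⱼ → to (nonEdge⇔ degree aᵢⱼ) (pairs i j i≢j)))

  count-around : ∀ (p : Fin m → Bool) y →
                 count (λ w → p w ∧ a y w) + count (λ w → p w ∧ nonNeighbour a y w) + ⟦ p y ⟧ ≡ count p
  count-around p y = begin
      count (λ w → p w ∧ a y w) + count (λ w → p w ∧ nonNeighbour a y w) + ⟦ p y ⟧
    ≡⟨ cong₂ _+_ (count-+ split) (sym (count-≟ p y)) ⟩
      count (λ w → p w ∧ not ⌊ y ≟ w ⌋) + count {m} (λ _ → false) + count (λ w → p w ∧ ⌊ y ≟ w ⌋)
    ≡⟨ cong (λ c → c + count (λ w → p w ∧ ⌊ y ≟ w ⌋))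
            (trans (cong (count (λ w → p w ∧ not ⌊ y ≟ w ⌋) +_) (count-false m)) (+-identityʳ _)) ⟩
      count (λ w → p w ∧ not ⌊ y ≟ w ⌋) + count (λ w → p w ∧ ⌊ y ≟ w ⌋)
    ≡⟨ count-+ recombine ⟩
      count p + count {m} (λ _ → false)
    ≡⟨ trans (cong (count p +_) (count-false m)) (+-identityʳ _) ⟩
      count p
    ∎
    where
    open ≡-Reasoning
    split : ∀ w → ⟦ p w ∧ a y w ⟧ + ⟦ p w ∧ nonNeighbour a y w ⟧
                    ≡ ⟦ p w ∧ not ⌊ y ≟ w ⌋ ⟧ + ⟦ false ⟧
    split w with y ≟ w
    ... | yes refl rewrite irrefl G y | ∧-zeroʳ (p y) = refl
    ... | no _ with p w | a y w
    ...   | true  | true  = refl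
    ...   | true  | false = refl
    ...   | false | _     = refl
    recombine : ∀ w → ⟦ p w ∧ not ⌊ y ≟ w ⌋ ⟧ + ⟦ p w ∧ ⌊ y ≟ w ⌋ ⟧ ≡ ⟦ p w ⟧ + ⟦ false ⟧
    recombine w with p w | ⌊ y ≟ w ⌋
    ... | true  | true  = refl
    ... | true  | false = refl
    ... | false | _     = refl

  nonNeighbour⇒ : ∀ {y z} → T (nonNeighbour a y z) → y ≢ z × a y z ≡ false
  nonNeighbour⇒ {y} {z} h with y ≟ z | a y z
  nonNeighbour⇒ () | yes _   | _
  nonNeighbour⇒ () | no _    | true
  nonNeighbour⇒ h  | no y≢z  | false = y≢z , refl

  dist2≡nonNeighbour : (∀ i j → i ≢ j → a i j ≡ false → 0 < commonNeighbours a i j) →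
                       ∀ y w → dist2 a y w ≡ nonNeighbour a y w
  dist2≡nonNeighbour connected y w with y ≟ w | a y w in aʸʷ
  ... | yes _   | _     = refl
  ... | no  _   | true  = refl
  ... | no  y≢w | false =
    let v , h = count-witness _ (connected y w y≢w aʸʷ) in
    to T-≡ (anyFin-intro v (subst (λ b → T (a y v ∧ b)) (SimpleGraph.sym G w v) h))

  extensible⇒stronglyRegular : ∀ {t s s̄} → Extensible a t s s̄ →
                               StronglyRegular a (2 * s) t s × Admissible m t s s̄
  extensible⇒stronglyRegular {t} {s} {s̄} (param , (diameter , y₀ , z₀ , far₀) , local , edge , size) =
    (degree , (λ i j aᵢⱼ → edge i j (from T-≡ aᵢⱼ)) , nonEdge) , param , size , 0<s̄
    where
    degree : ∀ i → count (a i) ≡ 2 * s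
    degree i = proj₁ (local i)
    nonEdge : ∀ i j → i ≢ j → a i j ≡ false → commonNeighbours a i j ≡ s
    nonEdge i j i≢j aᵢⱼ = proj₂ (proj₂ (proj₂ (proj₂ (local j))) i far)
      where
      far : T (dist2 a j i)
      far = subst (λ b → T (b ∨ dist2 a j i)) (trans (SimpleGraph.sym G j i) aᵢⱼ)
                  (diameter j i (i≢j ∘ sym))
    0<s̄ : 0 < s̄
    0<s̄ = *-cancelˡ-< 2 0 s̄ (subst (0 <_) (proj₁ (proj₂ (local y₀))) (0<count z₀ far₀))

  stronglyRegular⇒extensible : ∀ {t s s̄} → StronglyRegular a (2 * s) t s → Admissible m t s s̄ →
                               Extensible a t s s̄
  stronglyRegular⇒extensible {t} {s} {s̄} (degree , edgeCN , nonEdgeCN) (param , size , 0<s̄) =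
    param , (diameter , y₀ , far-witness)
          , (λ y → degree y , far-count y , neighbour y , distant y)
          , (λ y z h → edgeCN y z (to T-≡ h)) , size
    where
    open ≡-Reasoning

    0<s : 0 < s
    0<s = *-cancelˡ-< 2 0 s (subst (0 <_) param (subst (0 <_) (+-comm 1 (t + s̄)) (s≤s z≤n)))

    distance2 : ∀ y w → dist2 a y w ≡ nonNeighbour a y w
    distance2 = dist2≡nonNeighbour λ i j i≢j aᵢⱼ → subst (0 <_) (sym (nonEdgeCN i j i≢j aᵢⱼ)) 0<s

    around : ∀ y (p : Fin m → Bool) →
             count (λ w → p w ∧ a y w) + count (λ w → p w ∧ dist2 a y w) + ⟦ p y ⟧ ≡ count p
    around y p = trans (cong (λ c → count (λ w → p w ∧ a y w) + c + ⟦ p y ⟧)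
                             (count-cong λ w → cong (p w ∧_) (distance2 y w)))
                       (count-around p y)

    far-count : ∀ y → count (dist2 a y) ≡ 2 * s̄
    far-count y = +-cancel-middle (2 * s) 1 (begin
        2 * s + count (dist2 a y) + 1       ≡⟨ cong (λ d → d + count (dist2 a y) + 1) (sym (degree y)) ⟩
        count (a y) + count (dist2 a y) + 1 ≡⟨ around y (λ _ → true) ⟩
        count {m} (λ _ → true)              ≡⟨ trans (count-true m) size ⟩
        1 + 2 * s + 2 * s̄                   ≡⟨ rotate 1 (2 * s) (2 * s̄) ⟩
        2 * s + 2 * s̄ + 1                   ∎)
      where
      rotate : ∀ a b c → a + b + c ≡ b + c + a
      rotate = solve-∀

    neighbour : ∀ y z → T (a y z) →
                count (λ w → a z w ∧ dist2 a y w) ≡ s̄ × commonNeighbours a z y ≡ t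
    neighbour y z h = +-cancel-middle t 1 (begin
        t + count (λ w → a z w ∧ dist2 a y w) + 1
      ≡⟨ cong₂ (λ u v → u + count (λ w → a z w ∧ dist2 a y w) + v) (sym λ≡t) (cong ⟦_⟧ (sym aᶻʸ)) ⟩
        commonNeighbours a z y + count (λ w → a z w ∧ dist2 a y w) + ⟦ a z y ⟧
      ≡⟨ around y (a z) ⟩
        count (a z)
      ≡⟨ trans (degree z) (sym param) ⟩
        t + s̄ + 1
      ∎) , λ≡t
      where
      aᶻʸ : a z y ≡ true
      aᶻʸ = trans (SimpleGraph.sym G z y) (to T-≡ h)
      λ≡t : commonNeighbours a z y ≡ t
      λ≡t = edgeCN z y aᶻʸ

    distant : ∀ y z → T (dist2 a y z) →
              count (λ w → a z w ∧ dist2 a y w) ≡ s × commonNeighbours a z y ≡ s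
    distant y z h = +-cancel-middle s 0 (begin
        s + count (λ w → a z w ∧ dist2 a y w) + 0
      ≡⟨ cong₂ (λ u v → u + count (λ w → a z w ∧ dist2 a y w) + v) (sym μ≡s) (cong ⟦_⟧ (sym aᶻʸ)) ⟩
        commonNeighbours a z y + count (λ w → a z w ∧ dist2 a y w) + ⟦ a z y ⟧
      ≡⟨ around y (a z) ⟩
        count (a z)
      ≡⟨ trans (degree z) (double s) ⟩
        s + s + 0
      ∎) , μ≡s
      where
      nonAdjacent : y ≢ z × a y z ≡ false
      nonAdjacent = nonNeighbour⇒ (subst T (distance2 y z) h)
      aᶻʸ : a z y ≡ false
      aᶻʸ = trans (SimpleGraph.sym G z y) (proj₂ nonAdjacent)
      μ≡s : commonNeighbours a z y ≡ s
      μ≡s = nonEdgeCN z y (proj₁ nonAdjacent ∘ sym) aᶻʸ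
      double : ∀ s → 2 * s ≡ s + s + 0
      double = solve-∀

    diameter : ∀ y z → y ≢ z → T (a y z ∨ dist2 a y z)
    diameter y z y≢z rewrite distance2 y z | isYes-false (y ≟ z) y≢z = from T-≡ (∨-inverseʳ (a y z))

    y₀ : Fin m
    y₀ = subst Fin (sym size) zero

    far-witness : ∃ λ z → T (dist2 a y₀ z)
    far-witness = count-witness (dist2 a y₀) (subst (0 <_) (sym (far-count y₀)) (*-monoʳ-< 2 0<s̄))

  extensible⇔extendedTwoGraphRegular : ∀ {t s s̄} →
    Extensible a t s s̄ ⇔ (ExtendedTwoGraphRegular a (2 * s) × Admissible m t s s̄)
  extensible⇔extendedTwoGraphRegular = mk⇔
    (λ extensible →
       let regular , admissible@(param , size , _) = extensible⇒stronglyRegular extensible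
       in to (stronglyRegular⇔extendedTwoGraphRegular param size) regular , admissible)
    (λ (regular , admissible@(param , size , _)) →
       stronglyRegular⇒extensible
         (from (stronglyRegular⇔extendedTwoGraphRegular param size) regular) admissible)

-- Derived graphs

module _ {n : ℕ} (Γ : SimpleGraph (suc n)) where

  private
    a = adj Γ

  switchIsolate-sym : ∀ x i j → switchIsolate Γ x i j ≡ switchIsolate Γ x j i
  switchIsolate-sym x i j = cong₂ _xor_ (SimpleGraph.sym Γ i j) (xor-comm (a x i) (a x j))

  switchIsolate-isolates : ∀ x i → switchIsolate Γ x x i ≡ false
  switchIsolate-isolates x i rewrite irrefl Γ x = xor-same (a x i)

  derivedGraph : Fin (suc n) → SimpleGraph n
  derivedGraph x = record
    { adj    = derived Γ x
    ; sym    = λ i j → switchIsolate-sym x (punchIn x i) (punchIn x j)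
    ; irrefl = λ i → derived-irrefl x (punchIn x i)
    }
    where
    derived-irrefl : ∀ x i → switchIsolate Γ x i i ≡ false
    derived-irrefl x i rewrite irrefl Γ i = xor-same (a x i)

  oddTriangle-through : ∀ x i j → oddTriangle a x i j ≡ switchIsolate Γ x i j
  oddTriangle-through x i j = begin
      oddTriangle a x i j
    ≡⟨ sym (oddTriangle-switch a (a x) x i j) ⟩
      switchIsolate Γ x x i xor (switchIsolate Γ x i j xor switchIsolate Γ x j x)
    ≡⟨ cong₂ (λ u v → u xor (switchIsolate Γ x i j xor v))
             (switchIsolate-isolates x i)
             (trans (switchIsolate-sym x j x) (switchIsolate-isolates x j)) ⟩
      switchIsolate Γ x i j xor false
    ≡⟨ xor-identityʳ _ ⟩
      switchIsolate Γ x i j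
    ∎
    where open ≡-Reasoning

  degree-derived : ∀ x j → count (derived Γ x j) ≡ pairDegree a x (punchIn x j)
  degree-derived x j = sym (begin
      pairDegree a x (punchIn x j)
    ≡⟨ count-punchIn x (oddTriangle a x (punchIn x j)) ⟩
      ⟦ oddTriangle a x (punchIn x j) x ⟧ + count (oddTriangle a x (punchIn x j) ∘ punchIn x)
    ≡⟨ cong₂ _+_ (cong ⟦_⟧ (trans (oddTriangle-through x (punchIn x j) x)
                                  (trans (switchIsolate-sym x _ x) (switchIsolate-isolates x _))))
                 (count-cong λ k → oddTriangle-through x (punchIn x j) (punchIn x k)) ⟩
      count (derived Γ x j)
    ∎)
    where open ≡-Reasoning

  pairDegree-derived : ∀ x i j →
    ⟦ derived Γ x i j ⟧ + pairDegree (derived Γ x) i j ≡ pairDegree a (punchIn x i) (punchIn x j)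
  pairDegree-derived x i j = sym (begin
      pairDegree a (punchIn x i) (punchIn x j)
    ≡⟨ count-punchIn x (oddTriangle a (punchIn x i) (punchIn x j)) ⟩
      ⟦ oddTriangle a (punchIn x i) (punchIn x j) x ⟧
        + count (oddTriangle a (punchIn x i) (punchIn x j) ∘ punchIn x)
    ≡⟨ cong₂ _+_ (cong ⟦_⟧ (trans (oddTriangle-rotate a (punchIn x i) (punchIn x j) x)
                                  (oddTriangle-through x (punchIn x i) (punchIn x j))))
                 (count-cong λ k →
                    sym (oddTriangle-switch a (a x) (punchIn x i) (punchIn x j) (punchIn x k))) ⟩
      ⟦ derived Γ x i j ⟧ + pairDegree (derived Γ x) i j
    ∎)
    where open ≡-Reasoning

  derived⇒regularTwoGraph : ∀ {d} x → ExtendedTwoGraphRegular (derived Γ x) d → RegularTwoGraph a d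
  derived⇒regularTwoGraph x (degree , pairs) i j i≢j with punchIn-view x i | punchIn-view x j
  ... | inj₁ refl       | inj₁ refl       = ⊥-elim (i≢j refl)
  ... | inj₁ refl       | inj₂ (l , refl) = trans (sym (degree-derived x l)) (degree l)
  ... | inj₂ (k , refl) | inj₁ refl       =
    trans (pairDegree-sym Γ (punchIn x k) x) (trans (sym (degree-derived x k)) (degree k))
  ... | inj₂ (k , refl) | inj₂ (l , refl) =
    trans (sym (pairDegree-derived x k l)) (pairs k l (i≢j ∘ cong (punchIn x)))

  regularTwoGraph⇒derived : ∀ {d} → RegularTwoGraph a d → ∀ y → ExtendedTwoGraphRegular (derived Γ y) d
  regularTwoGraph⇒derived regular y =
      (λ j → trans (degree-derived y j) (regular y (punchIn y j) (punchInᵢ≢i y j ∘ sym)))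
    , (λ i j i≢j → trans (pairDegree-derived y i j) (regular _ _ (i≢j ∘ punchIn-injective y i j)))

proposition5 : (n : ℕ) (Γ : SimpleGraph (suc n)) → 3 ≤ suc n
    → (x : Fin (suc n)) (t s s̄ : ℕ) → Extensible (derived Γ x) t s s̄
    → (y : Fin (suc n)) → Extensible (derived Γ y) t s s̄
proposition5 n Γ _ x t s s̄ extensible y =
  let regularₓ , admissible = to (extensible⇔extendedTwoGraphRegular (derivedGraph Γ x)) extensible
  in from (extensible⇔extendedTwoGraphRegular (derivedGraph Γ y))
          (regularTwoGraph⇒derived Γ (derived⇒regularTwoGraph Γ x regularₓ) y , admissible)
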